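{- Let $S=\begin{pmatrix}0&-1\\1&0\end{pmatrix}$ and $T=\begin{pmatrix}1&1\\0&1\end{pmatrix}$. Let $\gamma=\begin{pmatrix}a&b\\c&d\end{pmatrix}\in SL_2(\mathbb{Z})$ with $c>0$, and let $$\gamma=(ST^{l_{\nu+1}})\cdots(ST^{l_1})(ST^{l_0})$$ be its Eichler canonical representation, i.e. $\nu\ge 0$ and $l_0,\dots,l_{\nu+1}\in\mathbb{Z}$ satisfy $(-1)^{j-1}l_j>0$ for $1\le j\le\nu$ and $(-1)^{\nu}l_{\nu+1}\ge 0$, with no condition on $l_0$. (a) If $l_{\nu+1}\neq 0$, then $|l_0l_1\cdots l_{\nu+1}|\le |d|$ if $l_0<0$; $|l_1\cdots l_{\nu+1}|\le |d-c|$ if $l_0=0$; and $|l_0l_1\cdots l_{\nu+1}|\le |c|+|d|$ if $l_0>0$. (b) If $l_{\nu+1}=0$, then $|l_0l_1\cdots l_{\nu-1}|\le |d|$ if $l_0<0$; $|l_1\cdots l_{\nu-1}|\le |d-c|$ if $l_0=0$; and $|l_0l_1\cdots l_{\nu-1}|\le |c|+|d|$ if $l_0>0$.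
   Context: $SL_2(\mathbb{Z})$ is the modular group of integer $2\times 2$ matrices of determinant $1$. Every $\gamma\in SL_2(\mathbb{Z})$ with lower-left entry $c>0$ has a unique representation of the displayed form (Eichler's canonical representation); moreover $l_{\nu+1}\neq 0$ if and only if $|a/c|<1$, and if $|a/c|\ge 1$ then $l_{\nu+1}=0$ and $l_\nu=\pm[|a/c|]$. -}

module Defs where

open import Data.Nat using (ℕ; zero; suc)
open import Data.Integer using (ℤ; +_; -_; _+_; _-_; _*_; _^_; -1ℤ; 0ℤ; 1ℤ)

record Mat2 : Set where
  constructor mat
  field
    a b c d : ℤ

open Mat2 public

infixl 7 _⊗_
_⊗_ : Mat2 → Mat2 → Mat2
mat a₁ b₁ c₁ d₁ ⊗ mat a₂ b₂ c₂ d₂ =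
  mat (a₁ * a₂ + b₁ * c₂) (a₁ * b₂ + b₁ * d₂)
      (c₁ * a₂ + d₁ * c₂) (c₁ * b₂ + d₁ * d₂)

det : Mat2 → ℤ
det (mat a b c d) = a * d - b * c

S : Mat2
S = mat 0ℤ -1ℤ 1ℤ 0ℤ

Tpow : ℤ → Mat2
Tpow l = mat 1ℤ l 0ℤ 1ℤ

ST : ℤ → Mat2
ST l = S ⊗ Tpow l

word : (ℕ → ℤ) → ℕ → Mat2
word l zero    = ST (l zero)
word l (suc n) = ST (l (suc n)) ⊗ word l n

prodFrom : (ℕ → ℤ) → ℕ → ℕ → ℤ
prodFrom l i zero    = 1ℤ
prodFrom l i (suc k) = l i * prodFrom l (suc i) k

sgn : ℕ → ℤ
sgn n = -1ℤ ^ n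

{-# OPTIONS --safe #-}
-- The lower row (c_n, d_n) of (S T^{l_{n-1}}) ⋯ (S T^{l_0}) obeys x_{n+2} = l_{n+1} x_{n+1} − x_n.
-- Twisting a solution by the signs 1, −1, −1, 1, 1, −1, −1, … turns this into the recurrence
-- y_{n+2} = e_{n+1} y_{n+1} + y_n with e_j = (−1)^{j−1} l_j, and Eichler's sign conditions say exactly
-- that e_1, …, e_{ν+1} ≥ 0. Once two consecutive terms y_i, y_{i+1} are non-negative, all later ones
-- are, and then y_{n+2} ≥ e_{n+1} y_{n+1}, so |y| grows at least by the factors |l_j|. Applied to d,
-- d − c and −(c + d), according to the sign of l_0, this gives the three bounds; when l_{ν+1} = 0
-- the recurrence gives |x_{ν+2}| = |x_ν|, which yields part (b).
module Submission where

open import Defs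
open import Function using (_∘_)
open import Data.Nat using (ℕ; zero; suc; _∸_; z≤n; s≤s) renaming (_≤_ to _≤ℕ_; _<_ to _<ℕ_)
import Data.Nat as ℕ
import Data.Nat.Properties as ℕP
open import Data.Integer using (ℤ; +_; -_; _+_; _-_; _*_; _<_; _≤_; ∣_∣; 0ℤ; 1ℤ; -1ℤ; +≤+; -≤+; _≟_)
import Data.Integer.Properties as ℤP
open import Data.Integer.Tactic.RingSolver using (solve-∀)
open import Data.Product using (_×_; _,_; proj₁; proj₂)
open import Data.Sum using (inj₁; inj₂)
open import Relation.Nullary using (yes; no)
open import Relation.Binary.PropositionalEquality

ThreeTerm⁻ : (ℕ → ℤ) → (ℕ → ℤ) → Set
ThreeTerm⁻ l x = ∀ n → x (suc (suc n)) ≡ l (suc n) * x (suc n) - x n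

ThreeTerm⁺ : (ℕ → ℤ) → (ℕ → ℤ) → Set
ThreeTerm⁺ e y = ∀ n → y (suc (suc n)) ≡ e (suc n) * y (suc n) + y n

solution : (ℕ → ℤ) → ℤ → ℤ → ℕ → ℤ
solution l x₀ x₁ zero          = x₀
solution l x₀ x₁ (suc zero)    = x₁
solution l x₀ x₁ (suc (suc n)) = l (suc n) * solution l x₀ x₁ (suc n) - solution l x₀ x₁ n

cSeq dSeq : (ℕ → ℤ) → ℕ → ℤ
cSeq l = solution l 0ℤ 1ℤ
dSeq l = solution l 1ℤ (l 0)

mat-cong : ∀ {a b c d a′ b′ c′ d′} → a ≡ a′ → b ≡ b′ → c ≡ c′ → d ≡ d′ → mat a b c d ≡ mat a′ b′ c′ d′
mat-cong refl refl refl refl = refl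

ST-entries : ∀ L → ST L ≡ mat 0ℤ -1ℤ 1ℤ L
ST-entries L = mat-cong refl refl refl (identity L)
  where
  identity : ∀ L → 1ℤ * L + 0ℤ * 1ℤ ≡ L
  identity = solve-∀

ST-step : ∀ L C₀ D₀ C₁ D₁ →
          mat 0ℤ -1ℤ 1ℤ L ⊗ mat (- C₀) (- D₀) C₁ D₁ ≡ mat (- C₁) (- D₁) (L * C₁ - C₀) (L * D₁ - D₀)
ST-step L C₀ D₀ C₁ D₁ = mat-cong (top C₀ C₁) (top D₀ D₁) (bottom L C₀ C₁) (bottom L D₀ D₁)
  where
  top : ∀ X₀ X₁ → 0ℤ * (- X₀) + -1ℤ * X₁ ≡ - X₁
  top = solve-∀
  bottom : ∀ L X₀ X₁ → 1ℤ * (- X₀) + L * X₁ ≡ L * X₁ - X₀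
  bottom = solve-∀

word-entries : ∀ l n → word l n ≡ mat (- cSeq l n) (- dSeq l n) (cSeq l (suc n)) (dSeq l (suc n))
word-entries l zero    = ST-entries (l 0)
word-entries l (suc n) =
  trans (cong₂ _⊗_ (ST-entries (l (suc n))) (word-entries l n))
        (ST-step (l (suc n)) (cSeq l n) (dSeq l n) (cSeq l (suc n)) (dSeq l (suc n)))

c-word : ∀ l n → c (word l n) ≡ cSeq l (suc n)
c-word l n = cong c (word-entries l n)

d-word : ∀ l n → d (word l n) ≡ dSeq l (suc n)
d-word l n = cong d (word-entries l n)

∣negSum∣≤∣c∣+∣d∣ : ∀ l n → ∣ - cSeq l (suc n) - dSeq l (suc n) ∣ ≤ℕ ∣ c (word l n) ∣ ℕ.+ ∣ d (word l n) ∣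
∣negSum∣≤∣c∣+∣d∣ l n = begin
  ∣ - cSeq l (suc n) - dSeq l (suc n) ∣         ≤⟨ ℤP.∣i-j∣≤∣i∣+∣j∣ (- cSeq l (suc n)) (dSeq l (suc n)) ⟩
  ∣ - cSeq l (suc n) ∣ ℕ.+ ∣ dSeq l (suc n) ∣   ≡⟨ cong (ℕ._+ ∣ dSeq l (suc n) ∣) (ℤP.∣-i∣≡∣i∣ (cSeq l (suc n))) ⟩
  ∣ cSeq l (suc n) ∣ ℕ.+ ∣ dSeq l (suc n) ∣     ≡⟨ cong₂ (λ p q → ∣ p ∣ ℕ.+ ∣ q ∣) (c-word l n) (d-word l n) ⟨
  ∣ c (word l n) ∣ ℕ.+ ∣ d (word l n) ∣         ∎
  where open ℕP.≤-Reasoning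

threeTerm⁻-vanishing : ∀ {l x n} → ThreeTerm⁻ l x → l (suc n) ≡ 0ℤ → ∣ x (suc (suc n)) ∣ ≡ ∣ x n ∣
threeTerm⁻-vanishing {l} {x} {n} rec l≡0 = begin
  ∣ x (suc (suc n)) ∣                   ≡⟨ cong ∣_∣ (rec n) ⟩
  ∣ l (suc n) * x (suc n) - x n ∣       ≡⟨ cong (λ L → ∣ L * x (suc n) - x n ∣) l≡0 ⟩
  ∣ 0ℤ * x (suc n) - x n ∣              ≡⟨ cong ∣_∣ (ℤP.+-identityˡ (- x n)) ⟩
  ∣ - x n ∣                             ≡⟨ ℤP.∣-i∣≡∣i∣ (x n) ⟩
  ∣ x n ∣                               ∎
  where open ≡-Reasoning

threeTerm⁻-neg : ∀ {l x} → ThreeTerm⁻ l x → ThreeTerm⁻ l (λ n → - x n)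
threeTerm⁻-neg {l} {x} rec n = trans (cong -_ (rec n)) (identity (l (suc n)) (x (suc n)) (x n))
  where
  identity : ∀ L X₁ X₀ → - (L * X₁ - X₀) ≡ L * (- X₁) - (- X₀)
  identity = solve-∀

threeTerm⁻-sub : ∀ {l x y} → ThreeTerm⁻ l x → ThreeTerm⁻ l y → ThreeTerm⁻ l (λ n → x n - y n)
threeTerm⁻-sub {l} {x} {y} recx recy n =
  trans (cong₂ _-_ (recx n) (recy n)) (identity (l (suc n)) (x (suc n)) (x n) (y (suc n)) (y n))
  where
  identity : ∀ L X₁ X₀ Y₁ Y₀ → (L * X₁ - X₀) - (L * Y₁ - Y₀) ≡ L * (X₁ - Y₁) - (X₀ - Y₀)
  identity = solve-∀

threeTerm⁻-dSeq-cSeq : ∀ l → ThreeTerm⁻ l (λ n → dSeq l n - cSeq l n)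
threeTerm⁻-dSeq-cSeq l = threeTerm⁻-sub {l} {dSeq l} {cSeq l} (λ _ → refl) (λ _ → refl)

threeTerm⁻-negSum : ∀ l → ThreeTerm⁻ l (λ n → - cSeq l n - dSeq l n)
threeTerm⁻-negSum l =
  threeTerm⁻-sub {l} {λ n → - cSeq l n} {dSeq l} (threeTerm⁻-neg {l} {cSeq l} (λ _ → refl)) (λ _ → refl)

alternate : (ℕ → ℤ) → ℕ → ℤ
alternate l j = sgn (j ∸ 1) * l j

twist : ℕ → ℤ
twist zero          = 1ℤ
twist (suc zero)    = -1ℤ
twist (suc (suc n)) = - twist n

twist-step : ∀ n → twist (suc (suc n)) ≡ sgn n * twist (suc n)
twist-step zero          = refl
twist-step (suc zero)    = refl
twist-step (suc (suc n)) = trans (cong -_ (twist-step n)) (identity (sgn n) (twist (suc n)))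
  where
  identity : ∀ g t → - (g * t) ≡ (-1ℤ * (-1ℤ * g)) * (- t)
  identity = solve-∀

threeTerm⁻⇒⁺ : ∀ {l x} → ThreeTerm⁻ l x → ThreeTerm⁺ (alternate l) (λ n → twist n * x n)
threeTerm⁻⇒⁺ {l} {x} rec n = begin
  twist (suc (suc n)) * x (suc (suc n))
    ≡⟨ cong (twist (suc (suc n)) *_) (rec n) ⟩
  (- twist n) * (l (suc n) * x (suc n) - x n)
    ≡⟨ expand (twist n) (l (suc n)) (x (suc n)) (x n) ⟩
  ((- twist n) * l (suc n)) * x (suc n) + twist n * x n
    ≡⟨ cong (λ s → (s * l (suc n)) * x (suc n) + twist n * x n) (twist-step n) ⟩
  ((sgn n * twist (suc n)) * l (suc n)) * x (suc n) + twist n * x n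
    ≡⟨ regroup (sgn n) (twist (suc n)) (l (suc n)) (x (suc n)) (twist n * x n) ⟩
  (sgn n * l (suc n)) * (twist (suc n) * x (suc n)) + twist n * x n
    ∎
  where
  open ≡-Reasoning
  expand : ∀ t L X₁ X₀ → (- t) * (L * X₁ - X₀) ≡ ((- t) * L) * X₁ + t * X₀
  expand = solve-∀
  regroup : ∀ g t L X₁ Y → ((g * t) * L) * X₁ + Y ≡ (g * L) * (t * X₁) + Y
  regroup = solve-∀

∣s∣≡1⇒∣s*i∣≡∣i∣ : ∀ s i → ∣ s ∣ ≡ 1 → ∣ s * i ∣ ≡ ∣ i ∣
∣s∣≡1⇒∣s*i∣≡∣i∣ s i ∣s∣≡1 = trans (ℤP.abs-* s i) (trans (cong (ℕ._* ∣ i ∣) ∣s∣≡1) (ℕP.*-identityˡ (∣ i ∣)))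

∣sgn∣≡1 : ∀ n → ∣ sgn n ∣ ≡ 1
∣sgn∣≡1 zero    = refl
∣sgn∣≡1 (suc n) = trans (∣s∣≡1⇒∣s*i∣≡∣i∣ -1ℤ (sgn n) refl) (∣sgn∣≡1 n)

∣twist∣≡1 : ∀ n → ∣ twist n ∣ ≡ 1
∣twist∣≡1 zero          = refl
∣twist∣≡1 (suc zero)    = refl
∣twist∣≡1 (suc (suc n)) = trans (ℤP.∣-i∣≡∣i∣ (twist n)) (∣twist∣≡1 n)

∣prodFrom-alternate∣ : ∀ l i k → ∣ prodFrom (alternate l) i k ∣ ≡ ∣ prodFrom l i k ∣
∣prodFrom-alternate∣ l i zero    = refl
∣prodFrom-alternate∣ l i (suc k) = begin
  ∣ alternate l i * prodFrom (alternate l) (suc i) k ∣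
    ≡⟨ ℤP.abs-* (alternate l i) _ ⟩
  ∣ alternate l i ∣ ℕ.* ∣ prodFrom (alternate l) (suc i) k ∣
    ≡⟨ cong₂ ℕ._*_ (∣s∣≡1⇒∣s*i∣≡∣i∣ (sgn (i ∸ 1)) (l i) (∣sgn∣≡1 (i ∸ 1))) (∣prodFrom-alternate∣ l (suc i) k) ⟩
  ∣ l i ∣ ℕ.* ∣ prodFrom l (suc i) k ∣
    ≡⟨ ℤP.abs-* (l i) _ ⟨
  ∣ l i * prodFrom l (suc i) k ∣
    ∎
  where open ≡-Reasoning

prodFrom-∘suc : ∀ f i k → prodFrom (f ∘ suc) i k ≡ prodFrom f (suc i) k
prodFrom-∘suc f i zero    = refl
prodFrom-∘suc f i (suc k) = cong (f (suc i) *_) (prodFrom-∘suc f (suc i) k)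

*-step : ∀ {e a b} → 0ℤ ≤ e → 0ℤ ≤ a → 0ℤ ≤ b → 0ℤ ≤ e * a + b × ∣ e ∣ ℕ.* ∣ a ∣ ≤ℕ ∣ e * a + b ∣
*-step (+≤+ {n = p} _) (+≤+ {n = q} _) (+≤+ {n = r} _) rewrite sym (ℤP.pos-* p q) =
  +≤+ z≤n , ℕP.m≤m+n (p ℕ.* q) r

0≤i⇒∣i∣≤∣1+i∣ : ∀ {i} → 0ℤ ≤ i → ∣ i ∣ ≤ℕ ∣ 1ℤ + i ∣
0≤i⇒∣i∣≤∣1+i∣ (+≤+ {n = n} _) = ℕP.n≤1+n n

threeTerm⁺-growth : ∀ k {e y} → ThreeTerm⁺ e y → (∀ j → j <ℕ k → 0ℤ ≤ e (suc j)) →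
                    0ℤ ≤ y 0 → 0ℤ ≤ y 1 → ∣ prodFrom e 1 k ∣ ℕ.* ∣ y 1 ∣ ≤ℕ ∣ y (suc k) ∣
threeTerm⁺-growth zero    _ _ _ _ = ℕP.≤-reflexive (ℕP.*-identityˡ _)
threeTerm⁺-growth (suc k) {e} {y} rec e≥0 y₀≥0 y₁≥0 = begin
  ∣ e 1 * P ∣ ℕ.* ∣ y 1 ∣                ≡⟨ cong (ℕ._* ∣ y 1 ∣) (ℤP.abs-* (e 1) P) ⟩
  (∣ e 1 ∣ ℕ.* ∣ P ∣) ℕ.* ∣ y 1 ∣        ≡⟨ cong (ℕ._* ∣ y 1 ∣) (ℕP.*-comm (∣ e 1 ∣) (∣ P ∣)) ⟩
  (∣ P ∣ ℕ.* ∣ e 1 ∣) ℕ.* ∣ y 1 ∣        ≡⟨ ℕP.*-assoc (∣ P ∣) (∣ e 1 ∣) (∣ y 1 ∣) ⟩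
  ∣ P ∣ ℕ.* (∣ e 1 ∣ ℕ.* ∣ y 1 ∣)        ≤⟨ ℕP.*-monoʳ-≤ (∣ P ∣) (proj₂ y₂-step) ⟩
  ∣ P ∣ ℕ.* ∣ y 2 ∣                      ≡⟨ cong (λ Q → ∣ Q ∣ ℕ.* ∣ y 2 ∣) (prodFrom-∘suc e 1 k) ⟨
  ∣ prodFrom (e ∘ suc) 1 k ∣ ℕ.* ∣ y 2 ∣ ≤⟨ threeTerm⁺-growth k {e ∘ suc} {y ∘ suc} (rec ∘ suc)
                                             (λ j j<k → e≥0 (suc j) (s≤s j<k)) y₁≥0 (proj₁ y₂-step) ⟩
  ∣ y (suc (suc k)) ∣                    ∎
  where
  open ℕP.≤-Reasoning
  P : ℤ
  P = prodFrom e 2 k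
  y₂-step : 0ℤ ≤ y 2 × ∣ e 1 ∣ ℕ.* ∣ y 1 ∣ ≤ℕ ∣ y 2 ∣
  y₂-step rewrite rec 0 = *-step (e≥0 0 (s≤s z≤n)) y₁≥0 y₀≥0

Alternating : (ℕ → ℤ) → ℕ → Set
Alternating l k = ∀ j → j <ℕ k → 0ℤ ≤ alternate l (suc j)

alternating-mono : ∀ {l k m} → k ≤ℕ m → Alternating l m → Alternating l k
alternating-mono k≤m alt j j<k = alt j (ℕP.<-≤-trans j<k k≤m)

eichler⇒alternating : ∀ {ν l} → (∀ j → 1 ≤ℕ j → j ≤ℕ ν → 0ℤ < sgn (j ∸ 1) * l j) → 0ℤ ≤ sgn ν * l (suc ν) →
                      Alternating l (suc ν)
eichler⇒alternating alternating last j j<1+ν with ℕP.m<1+n⇒m<n∨m≡n j<1+ν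
... | inj₁ j<ν  = ℤP.<⇒≤ (alternating (suc j) (s≤s z≤n) j<ν)
... | inj₂ refl = last

threeTerm⁻-growth : ∀ k {l x} → ThreeTerm⁻ l x → Alternating l k → 0ℤ ≤ x 0 → x 1 ≤ 0ℤ →
                    ∣ prodFrom l 1 k ∣ ℕ.* ∣ x 1 ∣ ≤ℕ ∣ x (suc k) ∣
threeTerm⁻-growth k {l} {x} rec alt x₀≥0 x₁≤0 = begin
  ∣ prodFrom l 1 k ∣ ℕ.* ∣ x 1 ∣                         ≡⟨ cong₂ ℕ._*_ (∣prodFrom-alternate∣ l 1 k) (∣twist*x∣ 1) ⟨
  ∣ prodFrom (alternate l) 1 k ∣ ℕ.* ∣ twist 1 * x 1 ∣   ≤⟨ threeTerm⁺-growth k {alternate l} {λ n → twist n * x n}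
                                                              (threeTerm⁻⇒⁺ {l} {x} rec) alt y₀≥0 y₁≥0 ⟩
  ∣ twist (suc k) * x (suc k) ∣                          ≡⟨ ∣twist*x∣ (suc k) ⟩
  ∣ x (suc k) ∣                                          ∎
  where
  open ℕP.≤-Reasoning
  ∣twist*x∣ : ∀ n → ∣ twist n * x n ∣ ≡ ∣ x n ∣
  ∣twist*x∣ n = ∣s∣≡1⇒∣s*i∣≡∣i∣ (twist n) (x n) (∣twist∣≡1 n)
  y₀≥0 : 0ℤ ≤ 1ℤ * x 0
  y₀≥0 = subst (0ℤ ≤_) (sym (ℤP.*-identityˡ (x 0))) x₀≥0
  y₁≥0 : 0ℤ ≤ -1ℤ * x 1
  y₁≥0 = subst (0ℤ ≤_) (sym (ℤP.-1*i≡-i (x 1))) (ℤP.neg-mono-≤ x₁≤0)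

dSeq-bound : ∀ m l → l 0 < 0ℤ → Alternating l (m ∸ 1) → ∣ prodFrom l 0 m ∣ ≤ℕ ∣ dSeq l m ∣
dSeq-bound zero          _ _    _   = ℕP.≤-refl
dSeq-bound (suc k)  l  l₀<0 alt = begin
  ∣ l 0 * prodFrom l 1 k ∣           ≡⟨ ℤP.abs-* (l 0) _ ⟩
  ∣ l 0 ∣ ℕ.* ∣ prodFrom l 1 k ∣     ≡⟨ ℕP.*-comm (∣ l 0 ∣) _ ⟩
  ∣ prodFrom l 1 k ∣ ℕ.* ∣ l 0 ∣     ≤⟨ threeTerm⁻-growth k {l} {dSeq l} (λ _ → refl) alt (+≤+ z≤n) (ℤP.<⇒≤ l₀<0) ⟩
  ∣ dSeq l (suc k) ∣                 ∎
  where open ℕP.≤-Reasoning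

dSeq-cSeq-bound : ∀ m l → l 0 ≡ 0ℤ → Alternating l (m ∸ 1) →
                  ∣ prodFrom l 1 (m ∸ 1) ∣ ≤ℕ ∣ dSeq l m - cSeq l m ∣
dSeq-cSeq-bound zero          _ _    _   = ℕP.≤-refl
dSeq-cSeq-bound (suc k)  l  l₀≡0 alt = begin
  ∣ prodFrom l 1 k ∣                 ≡⟨ ℕP.*-identityʳ _ ⟨
  ∣ prodFrom l 1 k ∣ ℕ.* 1           ≡⟨ cong (λ a → ∣ prodFrom l 1 k ∣ ℕ.* ∣ a - 1ℤ ∣) l₀≡0 ⟨
  ∣ prodFrom l 1 k ∣ ℕ.* ∣ x 1 ∣     ≤⟨ threeTerm⁻-growth k {l} {x} (threeTerm⁻-dSeq-cSeq l)
                                                           alt (+≤+ z≤n) x₁≤0 ⟩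
  ∣ x (suc k) ∣                      ∎
  where
  open ℕP.≤-Reasoning
  x : ℕ → ℤ
  x n = dSeq l n - cSeq l n
  x₁≤0 : x 1 ≤ 0ℤ
  x₁≤0 = subst (λ a → a - 1ℤ ≤ 0ℤ) (sym l₀≡0) -≤+

-- For x = −c − d the twisted sequence starts y₀ = −1, y₁ = 1 + l₀, so the growth argument is run from
-- index 1, with y₂ = l₀ l₁ + (l₁ − 1) supplying the first two factors.
negSum-growth : ∀ k l → 0ℤ < l 0 → 0ℤ < l 1 → Alternating l (suc k) →
                ∣ prodFrom l 0 (suc (suc k)) ∣ ≤ℕ ∣ - cSeq l (suc (suc k)) - dSeq l (suc (suc k)) ∣
negSum-growth k l 0<l₀ 0<l₁ alt = begin
  ∣ l 0 * (l 1 * P) ∣                              ≡⟨ ℤP.abs-* (l 0) (l 1 * P) ⟩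
  ∣ l 0 ∣ ℕ.* ∣ l 1 * P ∣                          ≡⟨ cong (∣ l 0 ∣ ℕ.*_) (ℤP.abs-* (l 1) P) ⟩
  ∣ l 0 ∣ ℕ.* (∣ l 1 ∣ ℕ.* ∣ P ∣)                  ≡⟨ ℕP.*-assoc (∣ l 0 ∣) (∣ l 1 ∣) (∣ P ∣) ⟨
  (∣ l 0 ∣ ℕ.* ∣ l 1 ∣) ℕ.* ∣ P ∣                  ≡⟨ ℕP.*-comm (∣ l 0 ∣ ℕ.* ∣ l 1 ∣) (∣ P ∣) ⟩
  ∣ P ∣ ℕ.* (∣ l 0 ∣ ℕ.* ∣ l 1 ∣)                  ≤⟨ ℕP.*-monoʳ-≤ (∣ P ∣) (proj₂ y₂-step) ⟩
  ∣ P ∣ ℕ.* ∣ y 2 ∣                                ≡⟨ cong (ℕ._* ∣ y 2 ∣) shifted-product ⟨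
  ∣ prodFrom (alternate l ∘ suc) 1 k ∣ ℕ.* ∣ y 2 ∣ ≤⟨ threeTerm⁺-growth k {alternate l ∘ suc} {y ∘ suc}
                                                        (threeTerm⁻⇒⁺ {l} {x} (threeTerm⁻-negSum l) ∘ suc)
                                                        (λ j j<k → alt (suc j) (s≤s j<k)) y₁≥0 (proj₁ y₂-step) ⟩
  ∣ y (suc (suc k)) ∣                              ≡⟨ ∣s∣≡1⇒∣s*i∣≡∣i∣ (twist (suc (suc k))) _
                                                                        (∣twist∣≡1 (suc (suc k))) ⟩
  ∣ x (suc (suc k)) ∣                              ∎
  where
  open ℕP.≤-Reasoning
  x y : ℕ → ℤ
  x n = - cSeq l n - dSeq l n
  y n = twist n * x n
  P : ℤ
  P = prodFrom l 2 k
  shifted-product : ∣ prodFrom (alternate l ∘ suc) 1 k ∣ ≡ ∣ P ∣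
  shifted-product = trans (cong ∣_∣ (prodFrom-∘suc (alternate l) 1 k)) (∣prodFrom-alternate∣ l 2 k)
  y₁-value : ∀ a → -1ℤ * (-1ℤ - a) ≡ 1ℤ + a
  y₁-value = solve-∀
  y₂-value : ∀ a b → -1ℤ * (- (b * 1ℤ - 0ℤ) - (b * a - 1ℤ)) ≡ a * b + (b - 1ℤ)
  y₂-value = solve-∀
  y₁≥0 : 0ℤ ≤ y 1
  y₁≥0 = subst (0ℤ ≤_) (sym (y₁-value (l 0))) (ℤP.i≤j⇒i≤k+j 1ℤ (ℤP.<⇒≤ 0<l₀))
  y₂-step : 0ℤ ≤ y 2 × ∣ l 0 ∣ ℕ.* ∣ l 1 ∣ ≤ℕ ∣ y 2 ∣
  y₂-step = subst (λ t → 0ℤ ≤ t × ∣ l 0 ∣ ℕ.* ∣ l 1 ∣ ≤ℕ ∣ t ∣) (sym (y₂-value (l 0) (l 1)))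
                  (*-step (ℤP.<⇒≤ 0<l₀) (ℤP.<⇒≤ 0<l₁) (ℤP.i≤j⇒0≤j-i (ℤP.i<j⇒suc[i]≤j 0<l₁)))

negSum-bound : ∀ m l → 0ℤ < l 0 → Alternating l (m ∸ 1) → ∣ prodFrom l 0 m ∣ ≤ℕ ∣ - cSeq l m - dSeq l m ∣
negSum-bound zero                 _ _    _   = ℕP.≤-refl
negSum-bound (suc zero)     l  0<l₀ _   = begin
  ∣ l 0 * 1ℤ ∣       ≡⟨ cong ∣_∣ (ℤP.*-identityʳ (l 0)) ⟩
  ∣ l 0 ∣            ≤⟨ 0≤i⇒∣i∣≤∣1+i∣ (ℤP.<⇒≤ 0<l₀) ⟩
  ∣ 1ℤ + l 0 ∣       ≡⟨ ℤP.∣-i∣≡∣i∣ (1ℤ + l 0) ⟨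
  ∣ - (1ℤ + l 0) ∣   ≡⟨ cong ∣_∣ (identity (l 0)) ⟩
  ∣ -1ℤ - l 0 ∣      ∎
  where
  open ℕP.≤-Reasoning
  identity : ∀ a → - (1ℤ + a) ≡ -1ℤ - a
  identity = solve-∀
negSum-bound (suc (suc k))  l  0<l₀ alt with l 1 ≟ 0ℤ
... | yes l₁≡0 = ℕP.≤-trans (ℕP.≤-reflexive (cong ∣_∣ product≡0)) z≤n
  where
  product≡0 : l 0 * (l 1 * prodFrom l 2 k) ≡ 0ℤ
  product≡0 = trans (cong (λ a → l 0 * (a * prodFrom l 2 k)) l₁≡0) (ℤP.*-zeroʳ (l 0))
... | no  l₁≢0 = negSum-growth k l 0<l₀ (ℤP.≤∧≢⇒< l₁≥0 (l₁≢0 ∘ sym)) alt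
  where
  l₁≥0 : 0ℤ ≤ l 1
  l₁≥0 = subst (0ℤ ≤_) (ℤP.*-identityˡ (l 1)) (alt 0 (s≤s z≤n))

EndpointBounds : ℕ → (ℕ → ℤ) → (ℕ → ℕ) → ℕ → Set
EndpointBounds ν l P t = (+ P (suc (suc ν)) ≤ + t) × (l (suc ν) ≡ 0ℤ → + P ν ≤ + t)

endpointBounds : ∀ ν l x (P : ℕ → ℕ) {t} → ThreeTerm⁻ l x → (∀ m → Alternating l (m ∸ 1) → P m ≤ℕ ∣ x m ∣) →
                 Alternating l (suc ν) → ∣ x (suc (suc ν)) ∣ ≤ℕ t → EndpointBounds ν l P t
endpointBounds ν l x P {t} rec bound alt x≤t =
    +≤+ (ℕP.≤-trans (bound (suc (suc ν)) alt) x≤t)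
  , λ l≡0 → +≤+ (ℕP.≤-trans (bound ν (alternating-mono {l} ν∸1≤1+ν alt))
                            (subst (_≤ℕ t) (threeTerm⁻-vanishing {l} {x} rec l≡0) x≤t))
  where
  ν∸1≤1+ν : ν ∸ 1 ≤ℕ suc ν
  ν∸1≤1+ν = ℕP.≤-trans (ℕP.m∸n≤m ν 1) (ℕP.n≤1+n ν)

proposition3p3 :
    (γ : Mat2) → det γ ≡ 1ℤ → 0ℤ < c γ →
    (ν : ℕ) (l : ℕ → ℤ) →
    (∀ j → 1 ≤ℕ j → j ≤ℕ ν → 0ℤ < sgn (j ∸ 1) * l j) →
    0ℤ ≤ sgn ν * l (suc ν) →
    γ ≡ word l (suc ν) →
    ((l (suc ν) ≢ 0ℤ) →
      ((l 0 < 0ℤ → + ∣ prodFrom l 0 (suc (suc ν)) ∣ ≤ + ∣ d γ ∣)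
      × (l 0 ≡ 0ℤ → + ∣ prodFrom l 1 (suc ν) ∣ ≤ + ∣ d γ - c γ ∣)
      × (0ℤ < l 0 → + ∣ prodFrom l 0 (suc (suc ν)) ∣ ≤ + ∣ c γ ∣ + + ∣ d γ ∣)))
    ×
    ((l (suc ν) ≡ 0ℤ) →
      ((l 0 < 0ℤ → + ∣ prodFrom l 0 ν ∣ ≤ + ∣ d γ ∣)
      × (l 0 ≡ 0ℤ → + ∣ prodFrom l 1 (ν ∸ 1) ∣ ≤ + ∣ d γ - c γ ∣)
      × (0ℤ < l 0 → + ∣ prodFrom l 0 ν ∣ ≤ + ∣ c γ ∣ + + ∣ d γ ∣)))
proposition3p3 γ _ _ ν l alternating last refl =
    (λ _ → proj₁ ∘ caseA , proj₁ ∘ caseB , proj₁ ∘ caseC)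
  , (λ l≡0 → (λ h → proj₂ (caseA h) l≡0) , (λ h → proj₂ (caseB h) l≡0) , (λ h → proj₂ (caseC h) l≡0))
  where
  W : Mat2
  W = word l (suc ν)
  alt : Alternating l (suc ν)
  alt = eichler⇒alternating alternating last
  caseA : l 0 < 0ℤ → EndpointBounds ν l (λ m → ∣ prodFrom l 0 m ∣) ∣ d W ∣
  caseA l₀<0 = endpointBounds ν l (dSeq l) _ (λ _ → refl) (λ m → dSeq-bound m l l₀<0) alt
                 (ℕP.≤-reflexive (cong ∣_∣ (sym (d-word l (suc ν)))))
  caseB : l 0 ≡ 0ℤ → EndpointBounds ν l (λ m → ∣ prodFrom l 1 (m ∸ 1) ∣) ∣ d W - c W ∣
  caseB l₀≡0 = endpointBounds ν l _ _ (threeTerm⁻-dSeq-cSeq l) (λ m → dSeq-cSeq-bound m l l₀≡0) alt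
                 (ℕP.≤-reflexive (cong₂ (λ p q → ∣ p - q ∣) (sym (d-word l (suc ν))) (sym (c-word l (suc ν)))))
  caseC : 0ℤ < l 0 → EndpointBounds ν l (λ m → ∣ prodFrom l 0 m ∣) (∣ c W ∣ ℕ.+ ∣ d W ∣)
  caseC 0<l₀ = endpointBounds ν l _ _ (threeTerm⁻-negSum l) (λ m → negSum-bound m l 0<l₀) alt
                 (∣negSum∣≤∣c∣+∣d∣ l (suc ν))
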